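{- For any positive integer $k$ and for $n\ge3$, $\dim_{k,f}(C_n)=\frac{n}{n-1}$ if $n\le 2k+3$ and $n$ is odd; $\dim_{k,f}(C_n)=\frac{n}{n-2}$ if $n\le 2k+3$ and $n$ is even; and $\dim_{k,f}(C_n)=\frac{n}{2(k+1)}$ if $n\ge 2k+4$.
   Context: $C_n$ is the cycle on $n$ vertices. $d(x,y)$ denotes the distance in a graph $G$. For a positive integer $k$, $d_k(x,y)=\min\{d(x,y),k+1\}$, and for distinct $x,y\in V(G)$, $R_k\{x,y\}=\{z\in V(G): d_k(x,z)\neq d_k(y,z)\}$. For $g$ defined on $V(G)$ and $U\subseteq V(G)$, $g(U)=\sum_{s\in U}g(s)$. A function $h:V(G)\to[0,1]$ is a $k$-truncated resolving function of $G$ if $h(R_k\{x,y\})\ge 1$ for all distinct $x,y\in V(G)$; $\dim_{k,f}(G)=\min\{h(V(G)): h \text{ is a } k\text{ -truncated resolving function of } G\}$.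
   Formalization: The $k$-truncated resolving functions of $C_n$ take only rational values in [0,1] rather than real values. -}

module Defs where

open import Data.Nat as ℕ using (ℕ; zero; suc; _⊓_; _∸_; ∣_-_∣)
open import Data.Fin using (Fin; toℕ) renaming (zero to fz; suc to fs)
open import Data.Integer using (+_)
open import Data.Rational as ℚ using (ℚ; 0ℚ; 1ℚ; _+_; _≤_; _/_)
open import Data.Product using (_×_; Σ)
open import Relation.Binary.PropositionalEquality using (_≡_; _≢_)
open import Relation.Nullary using (yes; no)

-- Graph distance in the cycle C_n with vertex set Fin n = {0,…,n-1},
-- where i ~ i+1 (mod n):  d(i,j) = min(|i-j|, n-|i-j|).
cycDist : (n : ℕ) → Fin n → Fin n → ℕ
cycDist n i j = ∣ toℕ i - toℕ j ∣ ⊓ (n ∸ ∣ toℕ i - toℕ j ∣)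

dk : (k n : ℕ) → Fin n → Fin n → ℕ
dk k n x y = cycDist n x y ⊓ suc k

sumFin : (n : ℕ) → (Fin n → ℚ) → ℚ
sumFin zero    f = 0ℚ
sumFin (suc n) f = f fz + sumFin n (λ i → f (fs i))

weightR : (k n : ℕ) → (Fin n → ℚ) → Fin n → Fin n → ℚ
weightR k n h x y = sumFin n λ z → sel (dk k n x z ℕ.≟ dk k n y z) (h z)
  where
  sel : ∀ {P : Set} → Relation.Nullary.Dec P → ℚ → ℚ
  sel (yes _) q = 0ℚ
  sel (no _)  q = q

IsResolving : (k n : ℕ) → (Fin n → ℚ) → Set
IsResolving k n h =
  ((z : Fin n) → (0ℚ ≤ h z) × (h z ≤ 1ℚ)) ×
  ((x y : Fin n) → x ≢ y → 1ℚ ≤ weightR k n h x y)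

-- dim_{k,f}(C_n) = v : v is attained by some resolving function and is a lower
-- bound for the total weight h(V) of every resolving function.
FracDimEq : (k n : ℕ) → ℚ → Set
FracDimEq k n v =
  Σ (Fin n → ℚ) (λ h → IsResolving k n h × (sumFin n h ≡ v)) ×
  ((h : Fin n → ℚ) → IsResolving k n h → v ≤ sumFin n h)

-- a / b as a rational (junk value 0 when b = 0; never used with b = 0 below)
ratio : ℕ → ℕ → ℚ
ratio a zero    = 0ℚ
ratio a (suc b) = (+ a) / suc b

{-# OPTIONS --safe #-}

-- C_n is vertex-transitive, so |R_k{x, y}| depends only on the offset d of y from x; call it r(d).
-- If r ≥ c everywhere, the constant function 1/c is resolving, of total weight n/c. If r(s) = c and h
-- is resolving, summing h(R_k{x, x + s}) ≥ 1 over all x counts every vertex c times, so h(V) ≥ n/c.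
-- To find the minimum of r, cut the cycle at 0 and d into arcs of lengths d and n - d, each taken
-- with one end. On an arc of length L the vertex at distances i and L - i from the ends resolves the
-- pair if min(i, L - i) ≤ k and i ≠ L - i, and does not if i = L - i or both exceed k. So an arc
-- with L ≤ 2k + 2 contributes at least L - 1 vertices (L if L is odd), a longer one at least 2k + 1,
-- and none more than 2k + 1. Hence min r is n - 1 or n - 2 for n ≤ 2k + 3 odd or even, attained at
-- d = 1 and d = 2, and 2k + 2 for n ≥ 2k + 4, attained at d = 1.

module Submission where

open import Defs
open import Data.Nat using (ℕ; _≤_; _+_; _*_; _∸_)
open import Data.Nat.Divisibility using (_∣_)
open import Data.Product using (_×_)
open import Relation.Nullary using (¬_)

open import Algebra.Bundles using (CommutativeRing)
open import Data.Bool using (Bool; true; false; if_then_else_; not)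
open import Data.Fin using (Fin; toℕ; fromℕ; fromℕ<; inject₁) renaming (zero to fz; suc to fs)
import Data.Fin.Properties as Finₚ
import Data.Integer as ℤ
import Data.Integer.Properties as ℤₚ
open import Data.Nat using (zero; suc; _<_; _≰_; _⊓_; ∣_-_∣; z≤n; s≤s)
open import Data.Nat.Divisibility using (divides; _∣?_; ∣m∣n⇒∣m+n; ∣m+n∣m⇒∣n; ∣1⇒≡1)
open import Data.Nat.Properties
open import Data.Product using (Σ; _,_; proj₁; proj₂)
open import Data.Rational as ℚ using (ℚ; 0ℚ; 1ℚ; toℚᵘ)
import Data.Rational.Properties as ℚₚ
open import Data.Rational.Unnormalised as ℚᵘ using (mkℚᵘ; *≡*)
import Data.Rational.Unnormalised.Properties as ℚᵘₚ
open import Data.Sum using (_⊎_; inj₁; inj₂)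
open import Function using (_∘_)
open import Relation.Binary.PropositionalEquality
open import Relation.Nullary using (yes; no; contradiction)
open import Relation.Nullary.Decidable using (isNo; isYes≗does; dec-true; dec-false)

open import Algebra.Properties.Semiring.Sum (CommutativeRing.semiring ℚₚ.+-*-commutativeRing)
  using (sum; sum-syntax; ∑-comm; sum-cong-≗; sum-init-last; sum-replicate; sum-replicate-zero)
open import Algebra.Properties.Semiring.Mult (CommutativeRing.semiring ℚₚ.+-*-commutativeRing)
  using (×-comm-*; ×-assoc-*) renaming (_×_ to _×ℚ_)

data Parity : ℕ → Set where
  even : ∀ m → Parity (m + m)
  odd  : ∀ m → Parity (suc (m + m))

parity : ∀ n → Parity n
parity zero = even 0
parity (suc n) with parity n
... | even m = odd m
... | odd m  = subst Parity (cong suc (+-suc m m)) (even (suc m))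

2∣m+m : ∀ m → 2 ∣ m + m
2∣m+m m = divides m (trans (cong (m +_) (sym (+-identityʳ m))) (*-comm 2 m))

2∤1+m+m : ∀ m → ¬ 2 ∣ suc (m + m)
2∤1+m+m m 2∣ with ∣1⇒≡1 (∣m+n∣m⇒∣n (subst (2 ∣_) (+-comm 1 (m + m)) 2∣) (2∣m+m m))
... | ()

half-≤ : ∀ {a b} → a + a ≤ suc (b + b) → a ≤ b
half-≤ {a} {b} le = subst₂ _≤_ (sym (n≡⌊n+n/2⌋ a)) (sym (n≡⌈n+n/2⌉ b)) (⌊n/2⌋-mono le)

2k+3≡ : ∀ k → 2 * k + 3 ≡ 3 + (k + k)
2k+3≡ k = trans (+-comm (2 * k) 3) (cong (λ x → 3 + (k + x)) (+-identityʳ k))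

2k+4≡ : ∀ k → 2 * k + 4 ≡ suc (suc (suc k + suc k))
2k+4≡ k = trans (+-comm (2 * k) 4)
  (cong (3 +_) (trans (cong (λ x → suc (k + x)) (+-identityʳ k)) (sym (+-suc k k))))

2[k+1]≡ : ∀ k → 2 * (k + 1) ≡ suc k + suc k
2[k+1]≡ k = trans (cong (λ x → x + (x + 0)) (+-comm k 1)) (cong (suc k +_) (+-identityʳ (suc k)))

count : (ℕ → Bool) → ℕ → ℕ
count p zero    = 0
count p (suc l) = (if p 0 then 1 else 0) + count (p ∘ suc) l

count-+ : ∀ p a b → count p (a + b) ≡ count p a + count (λ i → p (a + i)) b
count-+ p zero    b = refl
count-+ p (suc a) b = trans (cong (p₀ +_) (count-+ (p ∘ suc) a b)) (sym (+-assoc p₀ (count (p ∘ suc) a) _))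
  where p₀ = if p 0 then 1 else 0

count-≤ : ∀ p l → count p l ≤ l
count-≤ p zero    = z≤n
count-≤ p (suc l) with p 0
... | true  = s≤s (count-≤ (p ∘ suc) l)
... | false = m≤n⇒m≤1+n (count-≤ (p ∘ suc) l)

count-cong : ∀ {p q} l → (∀ i → i < l → p i ≡ q i) → count p l ≡ count q l
count-cong zero    eq = refl
count-cong (suc l) eq =
  cong₂ (λ b c → (if b then 1 else 0) + c) (eq 0 (s≤s z≤n))
        (count-cong l (λ i i<l → eq (suc i) (s≤s i<l)))

count-true : ∀ {p} l → (∀ i → i < l → p i ≡ true) → count p l ≡ l
count-true zero    all = refl
count-true (suc l) all rewrite all 0 (s≤s z≤n) = cong suc (count-true l (λ i i<l → all (suc i) (s≤s i<l)))

count-false : ∀ {p} l → (∀ i → i < l → p i ≡ false) → count p l ≡ 0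
count-false zero    none = refl
count-false (suc l) none rewrite none 0 (s≤s z≤n) = count-false l (λ i i<l → none (suc i) (s≤s i<l))

count-gap : ∀ p a g b → (∀ i → i < g → p (a + i) ≡ false) → count p (a + (g + b)) ≤ a + b
count-gap p a g b gap = begin
  count p (a + (g + b))                  ≡⟨ count-+ p a (g + b) ⟩
  count p a + count p′ (g + b)           ≡⟨ cong (count p a +_) (count-+ p′ g b) ⟩
  count p a + (count p′ g + count p″ b)  ≡⟨ cong (λ c → count p a + (c + count p″ b)) (count-false g gap) ⟩
  count p a + count p″ b                 ≤⟨ +-mono-≤ (count-≤ p a) (count-≤ p″ b) ⟩
  a + b                                  ∎
  where
  open ≤-Reasoning
  p′ = λ i → p (a + i)
  p″ = λ i → p′ (g + i)

-- Separating vertices on arcs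

-- cycDist n x y is offsetDist n ∣ toℕ x - toℕ y ∣ by definition.
offsetDist : ℕ → ℕ → ℕ
offsetDist n t = t ⊓ (n ∸ t)

offsetDist-≤ : ∀ n t → offsetDist n t ≤ t
offsetDist-≤ n t = m⊓n≤m t (n ∸ t)

≤-offsetDist : ∀ {n t e} → e ≤ t → e + t ≤ n → e ≤ offsetDist n t
≤-offsetDist e≤t e+t≤n = ⊓-glb e≤t (m+n≤o⇒m≤o∸n _ e+t≤n)

offsetDist-reflect : ∀ {n t} → t ≤ n → offsetDist n (n ∸ t) ≡ offsetDist n t
offsetDist-reflect {n} {t} t≤n = trans (cong ((n ∸ t) ⊓_) (m∸[m∸n]≡n t≤n)) (⊓-comm (n ∸ t) t)

-- A vertex whose labels differ by s and t from those of x and y lies in R_k{x, y} iff separates k n s t.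
separates : (k n s t : ℕ) → Bool
separates k n s t = isNo (offsetDist n s ⊓ suc k ≟ offsetDist n t ⊓ suc k)

separates-comm : ∀ k n s t → separates k n s t ≡ separates k n t s
separates-comm k n s t with offsetDist n s ⊓ suc k ≟ offsetDist n t ⊓ suc k
                          | offsetDist n t ⊓ suc k ≟ offsetDist n s ⊓ suc k
... | yes _  | yes _  = refl
... | no _   | no _   = refl
... | yes eq | no neq = contradiction (sym eq) neq
... | no neq | yes eq = contradiction (sym eq) neq

separates-reflectʳ : ∀ k {n t} s → t ≤ n → separates k n s (n ∸ t) ≡ separates k n s t
separates-reflectʳ k {n} s t≤n =
  cong (λ u → isNo (offsetDist n s ⊓ suc k ≟ u ⊓ suc k)) (offsetDist-reflect t≤n)

separates≡true : ∀ {k n s t} → offsetDist n s ⊓ suc k ≢ offsetDist n t ⊓ suc k →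
  separates k n s t ≡ true
separates≡true neq = cong not (trans (isYes≗does (_ ≟ _)) (dec-false (_ ≟ _) neq))

separates≡false : ∀ {k n s t} → offsetDist n s ⊓ suc k ≡ offsetDist n t ⊓ suc k →
  separates k n s t ≡ false
separates≡false eq = cong not (trans (isYes≗does (_ ≟ _)) (dec-true (_ ≟ _) eq))

separates-near : ∀ {k n s t} → s ≤ k → s < t → s + t < n → separates k n s t ≡ true
separates-near {k} {n} {s} {t} s≤k s<t s+t<n = separates≡true (<⇒≢ (begin-strict
  offsetDist n s ⊓ suc k  ≤⟨ m⊓n≤m _ (suc k) ⟩
  offsetDist n s          ≤⟨ offsetDist-≤ n s ⟩
  s                       <⟨ ⊓-glb (≤-offsetDist s<t s+t<n) (s≤s s≤k) ⟩
  offsetDist n t ⊓ suc k  ∎))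
  where open ≤-Reasoning

separates-far : ∀ {k n s t} → suc k ≤ offsetDist n s → suc k ≤ offsetDist n t → separates k n s t ≡ false
separates-far far-s far-t = separates≡false (trans (m≥n⇒m⊓n≡n far-s) (sym (m≥n⇒m⊓n≡n far-t)))

-- Separating vertices on an arc of length L between the two vertices of a pair, far end excluded:
-- vertex i of the arc differs from the two ends by i and L ∸ i.
arcCount : (k n L : ℕ) → ℕ
arcCount k n L = count (λ i → separates k n i (L ∸ i)) L

separates-arc-start : ∀ {k n L i} → i ≤ k → i < L ∸ i → L < n → separates k n i (L ∸ i) ≡ true
separates-arc-start {L = L} {i} i≤k i<L∸i L<n =
  separates-near i≤k i<L∸i (subst (_< _) (sym (m+[n∸m]≡n i≤L)) L<n)
  where
  i≤L : i ≤ L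
  i≤L = <⇒≤ (<-≤-trans i<L∸i (m∸n≤m L i))

separates-arc-end : ∀ {k n L i} → L ∸ i ≤ k → L ∸ i < i → i ≤ L → L < n → separates k n i (L ∸ i) ≡ true
separates-arc-end {k} {n} {L} {i} L∸i≤k L∸i<i i≤L L<n =
  trans (separates-comm k n i (L ∸ i))
        (separates-near L∸i≤k L∸i<i (subst (_< n) (sym (m∸n+n≡m i≤L)) L<n))

arcCount-ends : ∀ {k n} a g → a ≤ k → suc a + (g + a) < n → suc (a + a) ≤ arcCount k n (suc a + (g + a))
arcCount-ends {k} {n} a g a≤k L<n = begin
  suc a + a                                    ≡⟨ cong₂ _+_ (count-true (suc a) near-start) (count-true a near-end) ⟨
  count p (suc a) + count p″ a                 ≤⟨ +-monoʳ-≤ (count p (suc a)) (m≤n+m _ (count p′ g)) ⟩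
  count p (suc a) + (count p′ g + count p″ a)  ≡⟨ cong (count p (suc a) +_) (count-+ p′ g a) ⟨
  count p (suc a) + count p′ (g + a)           ≡⟨ count-+ p (suc a) (g + a) ⟨
  count p L                                    ∎
  where
  open ≤-Reasoning
  L = suc a + (g + a)
  p = λ i → separates k n i (L ∸ i)
  p′ = λ i → p (suc a + i)
  p″ = λ j → p′ (g + j)
  near-start : ∀ i → i < suc a → p i ≡ true
  near-start i (s≤s i≤a) = separates-arc-start (≤-trans i≤a a≤k)
    (m+n≤o⇒m≤o∸n (suc i) (+-mono-≤ (s≤s i≤a) (≤-trans i≤a (m≤n+m a g)))) L<n
  near-end : ∀ j → j < a → p″ j ≡ true
  near-end j j<a = separates-arc-end (subst (_≤ k) (sym L∸P) (≤-trans (m∸n≤m a j) a≤k))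
    (subst (_< P) (sym L∸P) (≤-trans (s≤s (m∸n≤m a j)) (m≤m+n (suc a) (g + j))))
    (+-monoʳ-≤ (suc a) (+-monoʳ-≤ g (<⇒≤ j<a))) L<n
    where
    P = suc a + (g + j)
    L∸P : L ∸ P ≡ a ∸ j
    L∸P = trans ([m+n]∸[m+o]≡n∸o (suc a) (g + a) (g + j)) ([m+n]∸[m+o]≡n∸o g a j)

arc-split : ∀ a {L} → suc (a + a) ≤ L → suc a + ((L ∸ suc (a + a)) + a) ≡ L
arc-split a {L} 2a<L = begin
  suc a + (g + a)       ≡⟨ cong (λ x → suc (a + x)) (+-comm g a) ⟩
  suc (a + (a + g))     ≡⟨ cong suc (+-assoc a a g) ⟨
  suc (a + a) + g       ≡⟨ m+[n∸m]≡n 2a<L ⟩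
  L                     ∎
  where
  open ≡-Reasoning
  g = L ∸ suc (a + a)

arcCount-≥ : ∀ {k n L} a → a ≤ k → suc (a + a) ≤ L → L < n → suc (a + a) ≤ arcCount k n L
arcCount-≥ {k} {n} a a≤k 2a<L L<n = subst (λ l → suc (a + a) ≤ arcCount k n l) (arc-split a 2a<L)
  (arcCount-ends a _ a≤k (subst (_< n) (sym (arc-split a 2a<L)) L<n))

arcCount-gap-≤ : ∀ {k n} g → suc k + (g + k) ≤ n → arcCount k n (suc k + (g + k)) ≤ suc k + k
arcCount-gap-≤ {k} {n} g L≤n = count-gap p (suc k) g k gap
  where
  L = suc k + (g + k)
  p = λ i → separates k n i (L ∸ i)
  gap : ∀ i → i < g → p (suc k + i) ≡ false
  gap i i<g = separates-far
    (≤-offsetDist (m≤m+n (suc k) i) (≤-trans (+-monoʳ-≤ (suc k) inner) L≤n))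
    (≤-offsetDist (subst (suc k ≤_) (sym L∸P) (m+n≤o⇒m≤o∸n (suc k) inner))
                  (≤-trans (+-monoʳ-≤ (suc k) (subst (_≤ g + k) (sym L∸P) (m∸n≤m (g + k) i))) L≤n))
    where
    inner : suc k + i ≤ g + k
    inner = subst (_≤ g + k) (cong suc (+-comm i k)) (+-monoˡ-≤ k i<g)
    L∸P : L ∸ (suc k + i) ≡ (g + k) ∸ i
    L∸P = [m+n]∸[m+o]≡n∸o (suc k) (g + k) i

arcCount-≤-length : ∀ k n L → arcCount k n L ≤ L
arcCount-≤-length k n L = count-≤ (λ i → separates k n i (L ∸ i)) L

arcCount-≤ : ∀ {k n L} → L ≤ n → arcCount k n L ≤ suc (k + k)
arcCount-≤ {k} {n} {L} L≤n with suc (k + k) ≤? L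
... | yes long = subst (λ l → arcCount k n l ≤ suc (k + k)) (arc-split k long)
                       (arcCount-gap-≤ _ (subst (_≤ n) (sym (arc-split k long)) L≤n))
... | no short = ≤-trans (arcCount-≤-length k n L) (<⇒≤ (≰⇒> short))

arcCount-midpoint : ∀ k n c → arcCount k n (suc c + suc c) ≤ suc c + c
arcCount-midpoint k n c = count-gap p (suc c) 1 c midpoint
  where
  L = suc c + suc c
  p = λ i → separates k n i (L ∸ i)
  midpoint : ∀ i → i < 1 → p (suc c + i) ≡ false
  midpoint (suc i) (s≤s ())
  midpoint zero    _ = separates≡false (cong (λ t → offsetDist n t ⊓ suc k) (sym half))
    where
    half : L ∸ (suc c + 0) ≡ suc c + 0
    half = trans (cong (L ∸_) (+-identityʳ (suc c)))
                 (trans (m+n∸m≡n (suc c) (suc c)) (sym (+-identityʳ (suc c))))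

resolvingCount : (k n d : ℕ) → ℕ
resolvingCount k n d = count (λ z → separates k n z ∣ d - z ∣) n

resolvingCount-arcs : ∀ k {n d} → d ≤ n → resolvingCount k n d ≡ arcCount k n d + arcCount k n (n ∸ d)
resolvingCount-arcs k {n} {d} d≤n = begin
  count p n                                    ≡⟨ cong (count p) (m+[n∸m]≡n d≤n) ⟨
  count p (d + (n ∸ d))                        ≡⟨ count-+ p d (n ∸ d) ⟩
  count p d + count (λ i → p (d + i)) (n ∸ d)  ≡⟨ cong₂ _+_ (count-cong d first) (count-cong (n ∸ d) second) ⟩
  arcCount k n d + arcCount k n (n ∸ d)        ∎
  where
  open ≡-Reasoning
  p = λ z → separates k n z ∣ d - z ∣
  first : ∀ i → i < d → p i ≡ separates k n i (d ∸ i)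
  first i i<d = cong (separates k n i) (m≤n⇒∣n-m∣≡n∸m (<⇒≤ i<d))
  second : ∀ i → i < n ∸ d → p (d + i) ≡ separates k n i ((n ∸ d) ∸ i)
  second i i<n∸d = begin
    separates k n (d + i) ∣ d - d + i ∣   ≡⟨ cong (separates k n (d + i)) (∣m-m+n∣≡n d i) ⟩
    separates k n (d + i) i               ≡⟨ separates-comm k n (d + i) i ⟩
    separates k n i (d + i)               ≡⟨ separates-reflectʳ k i d+i≤n ⟨
    separates k n i (n ∸ (d + i))         ≡⟨ cong (separates k n i) (∸-+-assoc n d i) ⟨
    separates k n i ((n ∸ d) ∸ i)         ∎
    where
    d+i≤n : d + i ≤ n
    d+i≤n = subst (d + i ≤_) (m+[n∸m]≡n d≤n) (+-monoʳ-≤ d (<⇒≤ i<n∸d))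

arcCount-short : ∀ {k n L} → 0 < L → L ≤ suc (suc (k + k)) → L < n →
  (L ≤ suc (arcCount k n L)) × (¬ 2 ∣ L → L ≤ arcCount k n L)
arcCount-short {k} {n} {L} 0<L L≤ L<n with parity L
... | odd m = m≤n⇒m≤1+n L≤arc , λ _ → L≤arc
  where
  L≤arc : L ≤ arcCount k n L
  L≤arc = arcCount-≥ m (half-≤ (≤-pred L≤)) ≤-refl L<n
... | even (suc a) = subst (_≤ suc (arcCount k n L)) L≡ (s≤s L-1≤arc) , contradiction (2∣m+m (suc a))
  where
  L≡ : suc (suc (a + a)) ≡ L
  L≡ = cong suc (sym (+-suc a a))
  a≤k : a ≤ k
  a≤k = half-≤ (m≤n⇒m≤1+n (≤-pred (≤-pred (subst (_≤ suc (suc (k + k))) (sym L≡) L≤))))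
  L-1≤arc : suc (a + a) ≤ arcCount k n L
  L-1≤arc = arcCount-≥ a a≤k (subst (suc (a + a) ≤_) L≡ (n≤1+n _)) L<n

arcCount-pos : ∀ {k n L} → 0 < L → L < n → 1 ≤ arcCount k n L
arcCount-pos = arcCount-≥ 0 z≤n

module _ {k n d : ℕ} (0<d : 0 < d) (d<n : d < n) where

  private
    d≤n = <⇒≤ d<n
    n≡ : d + (n ∸ d) ≡ n
    n≡ = m+[n∸m]≡n d≤n
    0<n∸d = m<n⇒0<n∸m d<n
    n∸d<n = ∸-monoʳ-< 0<d d≤n
    a₁ = arcCount k n d
    a₂ = arcCount k n (n ∸ d)
    arcs : resolvingCount k n d ≡ a₁ + a₂
    arcs = resolvingCount-arcs k d≤n

    two-defects : d ≤ suc (suc (k + k)) → n ∸ d ≤ suc (suc (k + k)) →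
      n ≤ suc (suc (resolvingCount k n d))
    two-defects d≤ n∸d≤ = begin
      n                                 ≡⟨ n≡ ⟨
      d + (n ∸ d)                       ≤⟨ +-mono-≤ (proj₁ (arcCount-short 0<d d≤ d<n))
                                                    (proj₁ (arcCount-short 0<n∸d n∸d≤ n∸d<n)) ⟩
      suc a₁ + suc a₂                   ≡⟨ cong suc (+-suc a₁ a₂) ⟩
      suc (suc (a₁ + a₂))               ≡⟨ cong (suc ∘ suc) arcs ⟨
      suc (suc (resolvingCount k n d))  ∎
      where open ≤-Reasoning

  resolvingCount-short : n ≤ 2 * k + 3 →
    (n ≤ suc (suc (resolvingCount k n d))) × (¬ 2 ∣ n → n ≤ suc (resolvingCount k n d))
  resolvingCount-short n≤ = two-defects (short d<n) (short n∸d<n) , one-defect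
    where
    open ≤-Reasoning
    short : ∀ {L} → L < n → L ≤ suc (suc (k + k))
    short L<n = ≤-pred (≤-trans L<n (≤-trans n≤ (≤-reflexive (2k+3≡ k))))
    one-defect : ¬ 2 ∣ n → n ≤ suc (resolvingCount k n d)
    one-defect 2∤n with 2 ∣? d
    ... | yes 2∣d = begin
      n                ≡⟨ n≡ ⟨
      d + (n ∸ d)      ≤⟨ +-mono-≤ (proj₁ (arcCount-short 0<d (short d<n) d<n))
                                   (proj₂ (arcCount-short 0<n∸d (short n∸d<n) n∸d<n) 2∤n∸d) ⟩
      suc (a₁ + a₂)    ≡⟨ cong suc arcs ⟨
      suc (resolvingCount k n d) ∎
      where
      2∤n∸d : ¬ 2 ∣ n ∸ d
      2∤n∸d 2∣n∸d = 2∤n (subst (2 ∣_) n≡ (∣m∣n⇒∣m+n 2∣d 2∣n∸d))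
    ... | no 2∤d = begin
      n                ≡⟨ n≡ ⟨
      d + (n ∸ d)      ≤⟨ +-mono-≤ (proj₂ (arcCount-short 0<d (short d<n) d<n) 2∤d)
                                   (proj₁ (arcCount-short 0<n∸d (short n∸d<n) n∸d<n)) ⟩
      a₁ + suc a₂      ≡⟨ +-suc a₁ a₂ ⟩
      suc (a₁ + a₂)    ≡⟨ cong suc arcs ⟨
      suc (resolvingCount k n d) ∎

  resolvingCount-long : 2 * k + 4 ≤ n → suc k + suc k ≤ resolvingCount k n d
  resolvingCount-long n≥ with suc (k + k) ≤? d | suc (k + k) ≤? n ∸ d
  ... | yes long₁ | _ = begin
    suc k + suc k                   ≡⟨ cong suc (+-suc k k) ⟩
    1 + suc (k + k)                 ≡⟨ +-comm 1 (suc (k + k)) ⟩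
    suc (k + k) + 1                 ≤⟨ +-mono-≤ (arcCount-≥ k ≤-refl long₁ d<n) (arcCount-pos 0<n∸d n∸d<n) ⟩
    a₁ + a₂                         ≡⟨ arcs ⟨
    resolvingCount k n d            ∎
    where open ≤-Reasoning
  ... | no _ | yes long₂ = begin
    suc k + suc k                   ≡⟨ cong suc (+-suc k k) ⟩
    1 + suc (k + k)                 ≤⟨ +-mono-≤ (arcCount-pos 0<d d<n) (arcCount-≥ k ≤-refl long₂ n∸d<n) ⟩
    a₁ + a₂                         ≡⟨ arcs ⟨
    resolvingCount k n d            ∎
    where open ≤-Reasoning
  ... | no short₁ | no short₂ = ≤-pred (≤-pred (begin
    suc (suc (suc k + suc k))       ≡⟨ 2k+4≡ k ⟨
    2 * k + 4                       ≤⟨ n≥ ⟩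
    n                               ≤⟨ two-defects (short short₁) (short short₂) ⟩
    suc (suc (resolvingCount k n d)) ∎))
    where
    open ≤-Reasoning
    short : ∀ {L} → suc (k + k) ≰ L → L ≤ suc (suc (k + k))
    short ≰ = m≤n⇒m≤1+n (m≤n⇒m≤1+n (≤-pred (≰⇒> ≰)))

resolvingCount-1-≤ : ∀ {k n} → 1 ≤ n → resolvingCount k n 1 ≤ suc k + suc k
resolvingCount-1-≤ {k} {n} 1≤n = begin
  resolvingCount k n 1                    ≡⟨ resolvingCount-arcs k 1≤n ⟩
  arcCount k n 1 + arcCount k n (n ∸ 1)   ≤⟨ +-mono-≤ (arcCount-≤-length k n 1) (arcCount-≤ (m∸n≤m n 1)) ⟩
  suc (suc (k + k))                       ≡⟨ cong suc (+-suc k k) ⟨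
  suc k + suc k                           ∎
  where open ≤-Reasoning

resolvingCount-odd-≤ : ∀ {k n} → 3 ≤ n → ¬ 2 ∣ n → resolvingCount k n 1 ≤ n ∸ 1
resolvingCount-odd-≤ {k} {n} 3≤n 2∤n with parity n
... | even m = contradiction (2∣m+m m) 2∤n
... | odd zero = contradiction 3≤n (λ { (s≤s ()) })
... | odd (suc c) = begin
  resolvingCount k n 1                              ≡⟨ resolvingCount-arcs k {n} (s≤s z≤n) ⟩
  arcCount k n 1 + arcCount k n (suc c + suc c)     ≤⟨ +-mono-≤ (arcCount-≤-length k n 1) (arcCount-midpoint k n c) ⟩
  suc (suc c + c)                                   ≡⟨ cong suc (+-suc c c) ⟨
  suc c + suc c                                     ∎
  where open ≤-Reasoning

resolvingCount-even-≤ : ∀ {k n} → 3 ≤ n → 2 ∣ n → resolvingCount k n 2 ≤ n ∸ 2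
resolvingCount-even-≤ {k} {n} 3≤n 2∣n with parity n
... | odd m = contradiction 2∣n (2∤1+m+m m)
... | even zero = contradiction 3≤n (λ ())
... | even (suc zero) = contradiction 3≤n (λ { (s≤s (s≤s ())) })
... | even (suc (suc c)) = begin
  resolvingCount k n 2                            ≡⟨ resolvingCount-arcs k {n} (s≤s (s≤s z≤n)) ⟩
  arcCount k n 2 + arcCount k n (n ∸ 2)           ≡⟨ cong (λ l → arcCount k n 2 + arcCount k n l) n∸2≡ ⟩
  arcCount k n 2 + arcCount k n (suc c + suc c)   ≤⟨ +-mono-≤ (arcCount-midpoint k n 0) (arcCount-midpoint k n c) ⟩
  suc (suc c + c)                                 ≡⟨ cong suc (+-suc c c) ⟨
  suc c + suc c                                   ≡⟨ n∸2≡ ⟨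
  n ∸ 2                                           ∎
  where
  open ≤-Reasoning
  n∸2≡ : n ∸ 2 ≡ suc c + suc c
  n∸2≡ = +-suc c (suc c)

1/suc : ℕ → ℚ
1/suc N = ratio 1 (suc N)

-- ratio a (suc N) is fromℚᵘ (mkℚᵘ (+ a) N) by definition, which toℚᵘ-fromℚᵘ undoes.
ratio-+ : ∀ a b N → ratio a (suc N) ℚ.+ ratio b (suc N) ≡ ratio (a + b) (suc N)
ratio-+ a b N = ℚₚ.toℚᵘ-injective (begin
  toℚᵘ (ratio a (suc N) ℚ.+ ratio b (suc N))          ≈⟨ ℚₚ.toℚᵘ-homo-+ (ratio a (suc N)) (ratio b (suc N)) ⟩
  toℚᵘ (ratio a (suc N)) ℚᵘ.+ toℚᵘ (ratio b (suc N))  ≈⟨ ℚᵘₚ.+-cong (ℚₚ.toℚᵘ-fromℚᵘ a/N) (ℚₚ.toℚᵘ-fromℚᵘ b/N) ⟩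
  a/N ℚᵘ.+ b/N                                        ≈⟨ *≡* common-denominator ⟩
  mkℚᵘ (ℤ.+ (a + b)) N                                ≈⟨ ℚₚ.toℚᵘ-fromℚᵘ (mkℚᵘ (ℤ.+ (a + b)) N) ⟨
  toℚᵘ (ratio (a + b) (suc N))                        ∎)
  where
  open ℚᵘₚ.≃-Reasoning
  a/N = mkℚᵘ (ℤ.+ a) N
  b/N = mkℚᵘ (ℤ.+ b) N
  M = ℤ.+ suc N
  common-denominator : (ℤ.+ a ℤ.* M ℤ.+ ℤ.+ b ℤ.* M) ℤ.* M ≡ ℤ.+ (a + b) ℤ.* (M ℤ.* M)
  common-denominator =
    trans (cong (ℤ._* M) (sym (ℤₚ.*-distribʳ-+ M (ℤ.+ a) (ℤ.+ b)))) (ℤₚ.*-assoc (ℤ.+ a ℤ.+ ℤ.+ b) M M)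

n/n≡1 : ∀ N → ratio (suc N) (suc N) ≡ 1ℚ
n/n≡1 N = ℚₚ.toℚᵘ-injective
  (ℚᵘₚ.≃-trans (ℚₚ.toℚᵘ-fromℚᵘ (mkℚᵘ (ℤ.+ suc N) N)) (*≡* (ℤₚ.*-comm (ℤ.+ suc N) (ℤ.+ 1))))

×ℚ-1/suc : ∀ a N → a ×ℚ 1/suc N ≡ ratio a (suc N)
×ℚ-1/suc zero    N = sym (ℚₚ.0/n≡0 (suc N))
×ℚ-1/suc (suc a) N = trans (cong (λ q → 1/suc N ℚ.+ q) (×ℚ-1/suc a N)) (ratio-+ 1 a N)

suc×ℚ1/suc : ∀ N → suc N ×ℚ 1/suc N ≡ 1ℚ
suc×ℚ1/suc N = trans (×ℚ-1/suc (suc N) N) (n/n≡1 N)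

1/suc-nonNeg : ∀ N → 0ℚ ℚ.≤ 1/suc N
1/suc-nonNeg N = ℚₚ.nonNegative⁻¹ (1/suc N) {{ℚₚ.normalize-nonNeg 1 (suc N)}}

×ℚ-nonNeg : ∀ {q} → 0ℚ ℚ.≤ q → ∀ c → 0ℚ ℚ.≤ c ×ℚ q
×ℚ-nonNeg 0≤q zero    = ℚₚ.≤-refl
×ℚ-nonNeg 0≤q (suc c) = ℚₚ.+-mono-≤ 0≤q (×ℚ-nonNeg 0≤q c)

×ℚ-monoˡ-≤ : ∀ {q a b} → 0ℚ ℚ.≤ q → a ≤ b → a ×ℚ q ℚ.≤ b ×ℚ q
×ℚ-monoˡ-≤ {b = b} 0≤q z≤n = ×ℚ-nonNeg 0≤q b
×ℚ-monoˡ-≤ {q} 0≤q (s≤s a≤b) = ℚₚ.+-monoʳ-≤ q (×ℚ-monoˡ-≤ 0≤q a≤b)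

×ℚ-≤⇒ratio-≤ : ∀ {n N H} → n ×ℚ 1ℚ ℚ.≤ suc N ×ℚ H → ratio n (suc N) ℚ.≤ H
×ℚ-≤⇒ratio-≤ {n} {N} {H} le = begin
  ratio n (suc N)        ≡⟨ ×ℚ-1/suc n N ⟨
  n ×ℚ ε                 ≡⟨ cong (n ×ℚ_) (ℚₚ.*-identityʳ ε) ⟨
  n ×ℚ (ε ℚ.* 1ℚ)        ≡⟨ ×-comm-* n ε 1ℚ ⟨
  ε ℚ.* (n ×ℚ 1ℚ)        ≤⟨ ℚₚ.*-monoˡ-≤-nonNeg ε {{ℚ.nonNegative (1/suc-nonNeg N)}} le ⟩
  ε ℚ.* (suc N ×ℚ H)     ≡⟨ ×-comm-* (suc N) ε H ⟩
  suc N ×ℚ (ε ℚ.* H)     ≡⟨ ×-assoc-* (suc N) ε H ⟨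
  (suc N ×ℚ ε) ℚ.* H     ≡⟨ cong (ℚ._* H) (suc×ℚ1/suc N) ⟩
  1ℚ ℚ.* H               ≡⟨ ℚₚ.*-identityˡ H ⟩
  H                      ∎
  where
  open ℚₚ.≤-Reasoning
  ε = 1/suc N

-- Sums over the cycle and its rotations

sumFin≡sum : ∀ n (f : Fin n → ℚ) → sumFin n f ≡ sum f
sumFin≡sum zero    f = refl
sumFin≡sum (suc n) f = cong (f fz ℚ.+_) (sumFin≡sum n (f ∘ fs))

sum-mono-≤ : ∀ {n} {f g : Fin n → ℚ} → (∀ i → f i ℚ.≤ g i) → sum f ℚ.≤ sum g
sum-mono-≤ {zero}  f≤g = ℚₚ.≤-refl
sum-mono-≤ {suc n} f≤g = ℚₚ.+-mono-≤ (f≤g fz) (sum-mono-≤ (f≤g ∘ fs))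

sum-if : ∀ {n} b (f : Fin n → ℚ) → ∑[ i < n ] (if b then f i else 0ℚ) ≡ (if b then sum f else 0ℚ)
sum-if true  f = refl
sum-if {n} false f = sum-replicate-zero n

sum-count : ∀ p {n} q → ∑[ i < n ] (if p (toℕ i) then q else 0ℚ) ≡ count p n ×ℚ q
sum-count p {zero}  q = refl
sum-count p {suc n} q with p 0
... | true  = cong (q ℚ.+_) (sum-count (p ∘ suc) {n} q)
... | false = trans (ℚₚ.+-identityˡ _) (sum-count (p ∘ suc) {n} q)

next : ∀ {m} → Fin (suc m) → Fin (suc m)
next {m} x with suc (toℕ x) <? suc m
... | yes x+1<n = fromℕ< x+1<n
... | no _      = fz

toℕ-next : ∀ {m} (x : Fin (suc m)) → toℕ x < m → toℕ (next x) ≡ suc (toℕ x)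
toℕ-next {m} x x<m with suc (toℕ x) <? suc m
... | yes x+1<n = Finₚ.toℕ-fromℕ< x+1<n
... | no  x+1≮n = contradiction (s≤s x<m) x+1≮n

toℕ-next-last : ∀ {m} (x : Fin (suc m)) → toℕ x ≡ m → toℕ (next x) ≡ 0
toℕ-next-last {m} x x≡m with suc (toℕ x) <? suc m
... | yes x+1<n = contradiction x≡m (<⇒≢ (≤-pred x+1<n))
... | no  _     = refl

inner-or-last : ∀ {m} (x : Fin (suc m)) → toℕ x < m ⊎ toℕ x ≡ m
inner-or-last x = m≤n⇒m<n∨m≡n (≤-pred (Finₚ.toℕ<n x))

sum-next : ∀ {m} (f : Fin (suc m) → ℚ) → ∑[ x < suc m ] f (next x) ≡ sum f
sum-next {m} f = begin
  ∑[ x < suc m ] f (next x)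
    ≡⟨ sum-init-last (f ∘ next) ⟩
  ∑[ i < m ] f (next (inject₁ i)) ℚ.+ f (next (fromℕ m))
    ≡⟨ cong₂ ℚ._+_ (sum-cong-≗ (cong f ∘ next-inject₁)) (cong f next-last) ⟩
  ∑[ i < m ] f (fs i) ℚ.+ f fz
    ≡⟨ ℚₚ.+-comm _ (f fz) ⟩
  sum f
    ∎
  where
  open ≡-Reasoning
  next-inject₁ : ∀ i → next (inject₁ i) ≡ fs i
  next-inject₁ i = Finₚ.toℕ-injective
    (trans (toℕ-next (inject₁ i) (Finₚ.inject₁ℕ< i)) (cong suc (Finₚ.toℕ-inject₁ i)))
  next-last : next (fromℕ m) ≡ fz
  next-last = Finₚ.toℕ-injective (toℕ-next-last (fromℕ m) (Finₚ.toℕ-fromℕ m))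

offsetDist-wrap : ∀ m c → c < m → offsetDist (suc m) (suc c) ≡ offsetDist (suc m) ∣ m - c ∣
offsetDist-wrap m c c<m = sym (trans (cong (offsetDist (suc m)) (m≤n⇒∣n-m∣≡n∸m (<⇒≤ c<m)))
                                     (offsetDist-reflect {suc m} {suc c} (s≤s (<⇒≤ c<m))))

cycDist-next : ∀ {m} (x z : Fin (suc m)) → cycDist (suc m) (next x) (next z) ≡ cycDist (suc m) x z
cycDist-next {m} x z with inner-or-last x | inner-or-last z
... | inj₁ x<m | inj₁ z<m rewrite toℕ-next x x<m | toℕ-next z z<m = refl
... | inj₂ x≡m | inj₁ z<m rewrite toℕ-next-last x x≡m | toℕ-next z z<m | x≡m = offsetDist-wrap m (toℕ z) z<m
... | inj₁ x<m | inj₂ z≡m rewrite toℕ-next x x<m | toℕ-next-last z z≡m | z≡m | ∣-∣-comm (toℕ x) m =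
  trans (cong (offsetDist (suc m)) (∣-∣-comm (suc (toℕ x)) 0)) (offsetDist-wrap m (toℕ x) x<m)
... | inj₂ x≡m | inj₂ z≡m rewrite toℕ-next-last x x≡m | toℕ-next-last z z≡m | x≡m | z≡m | ∣n-n∣≡0 m =
  refl

next-injective : ∀ {m} {x z : Fin (suc m)} → next x ≡ next z → x ≡ z
next-injective {m} {x} {z} eq with inner-or-last x | inner-or-last z
... | inj₁ x<m | inj₁ z<m = Finₚ.toℕ-injective (suc-injective
  (trans (sym (toℕ-next x x<m)) (trans (cong toℕ eq) (toℕ-next z z<m))))
... | inj₁ x<m | inj₂ z≡m = contradiction
  (trans (sym (toℕ-next x x<m)) (trans (cong toℕ eq) (toℕ-next-last z z≡m))) λ ()
... | inj₂ x≡m | inj₁ z<m = contradiction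
  (trans (sym (toℕ-next z z<m)) (trans (cong toℕ (sym eq)) (toℕ-next-last x x≡m))) λ ()
... | inj₂ x≡m | inj₂ z≡m = Finₚ.toℕ-injective (trans x≡m (sym z≡m))

rotate : ∀ {m} → ℕ → Fin (suc m) → Fin (suc m)
rotate zero    x = x
rotate (suc t) x = next (rotate t x)

rotate-+ : ∀ {m} a b (x : Fin (suc m)) → rotate a (rotate b x) ≡ rotate (a + b) x
rotate-+ zero    b x = refl
rotate-+ (suc a) b x = cong next (rotate-+ a b x)

rotate-injective : ∀ {m} t {x z : Fin (suc m)} → rotate t x ≡ rotate t z → x ≡ z
rotate-injective zero    eq = eq
rotate-injective (suc t) eq = rotate-injective t (next-injective eq)

dk-rotate : ∀ k {m} t (x z : Fin (suc m)) → dk k (suc m) (rotate t x) (rotate t z) ≡ dk k (suc m) x z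
dk-rotate k zero    x z = refl
dk-rotate k (suc t) x z = trans (cong (_⊓ suc k) (cycDist-next (rotate t x) (rotate t z))) (dk-rotate k t x z)

sum-rotate : ∀ {m} t (f : Fin (suc m) → ℚ) → ∑[ x < suc m ] f (rotate t x) ≡ sum f
sum-rotate zero    f = refl
sum-rotate (suc t) f = trans (sum-rotate t (f ∘ next)) (sum-next f)

toℕ-rotate-fz : ∀ {m} a → a < suc m → toℕ (rotate {m} a fz) ≡ a
toℕ-rotate-fz zero    _ = refl
toℕ-rotate-fz {m} (suc a) a+1<n = trans (toℕ-next _ (subst (_< m) (sym IH) (≤-pred a+1<n))) (cong suc IH)
  where
  IH : toℕ (rotate {m} a fz) ≡ a
  IH = toℕ-rotate-fz a (<-trans (n<1+n a) a+1<n)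

rotate-fz : ∀ {m} (x : Fin (suc m)) → rotate (toℕ x) fz ≡ x
rotate-fz x = Finₚ.toℕ-injective (toℕ-rotate-fz (toℕ x) (Finₚ.toℕ<n x))

rotate-comm : ∀ {m} (x w : Fin (suc m)) → rotate (toℕ x) w ≡ rotate (toℕ w) x
rotate-comm x w = begin
  rotate (toℕ x) w                    ≡⟨ cong (rotate (toℕ x)) (rotate-fz w) ⟨
  rotate (toℕ x) (rotate (toℕ w) fz)  ≡⟨ rotate-+ (toℕ x) (toℕ w) fz ⟩
  rotate (toℕ x + toℕ w) fz           ≡⟨ cong (λ t → rotate t fz) (+-comm (toℕ x) (toℕ w)) ⟩
  rotate (toℕ w + toℕ x) fz           ≡⟨ rotate-+ (toℕ w) (toℕ x) fz ⟨
  rotate (toℕ w) (rotate (toℕ x) fz)  ≡⟨ cong (rotate (toℕ w)) (rotate-fz x) ⟩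
  rotate (toℕ w) x                    ∎
  where open ≡-Reasoning

rotate-to-fz : ∀ {m} (x : Fin (suc m)) → rotate (suc m ∸ toℕ x) x ≡ fz
rotate-to-fz {m} x = begin
  rotate t x                    ≡⟨ cong (rotate t) (rotate-fz x) ⟨
  rotate t (rotate (toℕ x) fz)  ≡⟨ rotate-+ t (toℕ x) fz ⟩
  rotate (t + toℕ x) fz         ≡⟨ cong (λ u → rotate u fz) (m∸n+n≡m (<⇒≤ (Finₚ.toℕ<n x))) ⟩
  rotate (suc m) fz             ≡⟨ Finₚ.toℕ-injective (toℕ-next-last _ (toℕ-rotate-fz m ≤-refl)) ⟩
  fz                            ∎
  where
  open ≡-Reasoning
  t = suc m ∸ toℕ x

-- The fractional dimension

resolves : (k n : ℕ) → Fin n → Fin n → Fin n → Bool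
resolves k n x y z = isNo (dk k n x z ≟ dk k n y z)

-- The summand of weightR is local to Defs; unfolded names it so that `with` can split the decision in
-- it. resolves uses isNo rather than does because does (a ≟ b) reduces to a ≡ᵇ b, hiding the decision.
weightR-sum : ∀ k n h (x y : Fin n) → weightR k n h x y ≡ ∑[ z < n ] (if resolves k n x y z then h z else 0ℚ)
weightR-sum k n h x y = trans (proj₂ unfolded) (trans (sumFin≡sum n (proj₁ unfolded)) (sum-cong-≗ summand))
  where
  unfolded : Σ (Fin n → ℚ) λ f → weightR k n h x y ≡ sumFin n f
  unfolded = _ , refl
  summand : ∀ z → proj₁ unfolded z ≡ (if resolves k n x y z then h z else 0ℚ)
  summand z with dk k n x z ≟ dk k n y z
  ... | yes _ = refl
  ... | no _  = refl

resolves-rotate : ∀ k {m} t (x y z : Fin (suc m)) →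
  resolves k (suc m) (rotate t x) (rotate t y) (rotate t z) ≡ resolves k (suc m) x y z
resolves-rotate k t x y z = cong₂ (λ a b → isNo (a ≟ b)) (dk-rotate k t x z) (dk-rotate k t y z)

weightR-rotate : ∀ k {m} t h (x y : Fin (suc m)) → weightR k (suc m) h (rotate t x) (rotate t y) ≡
  ∑[ w < suc m ] (if resolves k (suc m) x y w then h (rotate t w) else 0ℚ)
weightR-rotate k {m} t h x y = begin
  weightR k n h (rotate t x) (rotate t y)
    ≡⟨ weightR-sum k n h (rotate t x) (rotate t y) ⟩
  ∑[ z < n ] (if resolves k n (rotate t x) (rotate t y) z then h z else 0ℚ)
    ≡⟨ sum-rotate t (λ z → if resolves k n (rotate t x) (rotate t y) z then h z else 0ℚ) ⟨
  ∑[ w < n ] (if resolves k n (rotate t x) (rotate t y) (rotate t w) then h (rotate t w) else 0ℚ)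
    ≡⟨ sum-cong-≗ (λ w → cong (λ b → if b then h (rotate t w) else 0ℚ) (resolves-rotate k t x y w)) ⟩
  ∑[ w < n ] (if resolves k n x y w then h (rotate t w) else 0ℚ)
    ∎
  where
  open ≡-Reasoning
  n = suc m

weightR-uniform : ∀ k {m} q (x y : Fin (suc m)) →
  weightR k (suc m) (λ _ → q) x y ≡ resolvingCount k (suc m) (toℕ (rotate (suc m ∸ toℕ x) y)) ×ℚ q
weightR-uniform k {m} q x y = begin
  weightR k n (λ _ → q) x y
    ≡⟨ weightR-sum k n (λ _ → q) x y ⟩
  ∑[ w < n ] (if resolves k n x y w then q else 0ℚ)
    ≡⟨ weightR-rotate k t (λ _ → q) x y ⟨
  weightR k n (λ _ → q) (rotate t x) y′
    ≡⟨ cong (λ x′ → weightR k n (λ _ → q) x′ y′) (rotate-to-fz x) ⟩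
  weightR k n (λ _ → q) fz y′
    ≡⟨ weightR-sum k n (λ _ → q) fz y′ ⟩
  ∑[ w < n ] (if resolves k n fz y′ w then q else 0ℚ)
    ≡⟨ sum-count (λ i → separates k n i ∣ toℕ y′ - i ∣) {n} q ⟩
  resolvingCount k n (toℕ y′) ×ℚ q
    ∎
  where
  open ≡-Reasoning
  n = suc m
  t = n ∸ toℕ x
  y′ = rotate t y

uniform-isResolving : ∀ {k m N} → (∀ d → 0 < d → d < suc m → suc N ≤ resolvingCount k (suc m) d) →
  IsResolving k (suc m) (λ _ → 1/suc N)
uniform-isResolving {k} {m} {N} enough = (λ _ → 1/suc-nonNeg N , 1/suc≤1) , resolved
  where
  open ℚₚ.≤-Reasoning
  1/suc≤1 : 1/suc N ℚ.≤ 1ℚ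
  1/suc≤1 = begin
    1/suc N             ≡⟨ ℚₚ.+-identityʳ (1/suc N) ⟨
    1 ×ℚ 1/suc N        ≤⟨ ×ℚ-monoˡ-≤ (1/suc-nonNeg N) (s≤s (z≤n {N})) ⟩
    suc N ×ℚ 1/suc N    ≡⟨ suc×ℚ1/suc N ⟩
    1ℚ                  ∎
  resolved : ∀ x y → x ≢ y → 1ℚ ℚ.≤ weightR k (suc m) (λ _ → 1/suc N) x y
  resolved x y x≢y = begin
    1ℚ                                    ≡⟨ suc×ℚ1/suc N ⟨
    suc N ×ℚ 1/suc N                      ≤⟨ ×ℚ-monoˡ-≤ (1/suc-nonNeg N) (enough d 0<d (Finₚ.toℕ<n y′)) ⟩
    resolvingCount k (suc m) d ×ℚ 1/suc N ≡⟨ weightR-uniform k (1/suc N) x y ⟨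
    weightR k (suc m) (λ _ → 1/suc N) x y ∎
    where
    t = suc m ∸ toℕ x
    y′ = rotate t y
    d = toℕ y′
    0<d : 0 < d
    0<d = n≢0⇒n>0 λ d≡0 →
      x≢y (rotate-injective t (trans (rotate-to-fz x) (sym (Finₚ.toℕ-injective {i = y′} {j = fz} d≡0))))

-- Over the n rotations of the pair (0, s), every vertex lies in R_k exactly resolvingCount k n s times.
ratio≤sumFin : ∀ {k m N s} → 0 < s → s < suc m → resolvingCount k (suc m) s ≤ suc N →
  ∀ h → IsResolving k (suc m) h → ratio (suc m) (suc N) ℚ.≤ sumFin (suc m) h
ratio≤sumFin {k} {m} {N} {s} 0<s s<n few h (bounds , resolving) =
  subst (ratio n (suc N) ℚ.≤_) (sym (sumFin≡sum n h)) (×ℚ-≤⇒ratio-≤ {n} {N} (begin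
  n ×ℚ 1ℚ
    ≡⟨ sum-replicate n {1ℚ} ⟨
  ∑[ x < n ] 1ℚ
    ≤⟨ sum-mono-≤ {n} (λ x → resolving _ _ (distinct x)) ⟩
  ∑[ x < n ] weightR k n h (ρ x fz) (ρ x s̄)
    ≡⟨ sum-cong-≗ {n} (λ x → weightR-rotate k (toℕ x) h fz s̄) ⟩
  ∑[ x < n ] ∑[ w < n ] (if res w then h (ρ x w) else 0ℚ)
    ≡⟨ ∑-comm (λ x w → if res w then h (ρ x w) else 0ℚ) ⟩
  ∑[ w < n ] ∑[ x < n ] (if res w then h (ρ x w) else 0ℚ)
    ≡⟨ sum-cong-≗ {n} (λ w → sum-if (res w) (λ x → h (ρ x w))) ⟩
  ∑[ w < n ] (if res w then ∑[ x < n ] h (ρ x w) else 0ℚ)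
    ≡⟨ sum-cong-≗ {n} (λ w → cong (λ S → if res w then S else 0ℚ) (orbit-sum w)) ⟩
  ∑[ w < n ] (if res w then sum h else 0ℚ)
    ≡⟨ sum-count (λ i → separates k n i ∣ toℕ s̄ - i ∣) {n} (sum h) ⟩
  resolvingCount k n (toℕ s̄) ×ℚ sum h
    ≤⟨ ×ℚ-monoˡ-≤ h≥0 (subst (λ d → resolvingCount k n d ≤ suc N) (sym toℕ-s̄) few) ⟩
  suc N ×ℚ sum h
    ∎))
  where
  open ℚₚ.≤-Reasoning
  n = suc m
  ρ : Fin n → Fin n → Fin n
  ρ x = rotate (toℕ x)
  s̄ = fromℕ< s<n
  toℕ-s̄ : toℕ s̄ ≡ s
  toℕ-s̄ = Finₚ.toℕ-fromℕ< s<n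
  res = resolves k n fz s̄
  distinct : ∀ x → ρ x fz ≢ ρ x s̄
  distinct x eq = <⇒≢ 0<s (trans (cong toℕ (rotate-injective (toℕ x) eq)) toℕ-s̄)
  orbit-sum : ∀ w → ∑[ x < n ] h (ρ x w) ≡ sum h
  orbit-sum w = trans (sum-cong-≗ {n} (λ x → cong h (rotate-comm x w))) (sum-rotate (toℕ w) h)
  h≥0 : 0ℚ ℚ.≤ sum h
  h≥0 = ℚₚ.≤-trans (ℚₚ.≤-reflexive (sym (sum-replicate-zero n))) (sum-mono-≤ {n} (proj₁ ∘ bounds))

minCount⇒fracDimEq : ∀ {k m N s} → (∀ d → 0 < d → d < suc m → suc N ≤ resolvingCount k (suc m) d) →
  0 < s → s < suc m → resolvingCount k (suc m) s ≤ suc N → FracDimEq k (suc m) (ratio (suc m) (suc N))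
minCount⇒fracDimEq {m = m} {N} enough 0<s s<n few =
  ((λ _ → 1/suc N) , uniform-isResolving enough , total) , ratio≤sumFin 0<s s<n few
  where
  total : sumFin (suc m) (λ _ → 1/suc N) ≡ ratio (suc m) (suc N)
  total = trans (sumFin≡sum (suc m) (λ _ → 1/suc N))
                (trans (sum-replicate (suc m) {1/suc N}) (×ℚ-1/suc (suc m) N))

theorem3p4 : (k n : ℕ) → 1 ≤ k → 3 ≤ n →
    ((n ≤ 2 * k + 3 → ¬ (2 ∣ n) → FracDimEq k n (ratio n (n ∸ 1))) ×
     (n ≤ 2 * k + 3 → 2 ∣ n → FracDimEq k n (ratio n (n ∸ 2)))) ×
    (2 * k + 4 ≤ n → FracDimEq k n (ratio n (2 * (k + 1))))
theorem3p4 k 0 _ ()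
theorem3p4 k 1 _ (s≤s ())
theorem3p4 k 2 _ (s≤s (s≤s ()))
theorem3p4 k n@(suc (suc (suc p))) _ 3≤n = (odd-case , even-case) , long-case
  where
  odd-case : n ≤ 2 * k + 3 → ¬ (2 ∣ n) → FracDimEq k n (ratio n (n ∸ 1))
  odd-case n≤ 2∤n = minCount⇒fracDimEq
    (λ d 0<d d<n → ≤-pred (proj₂ (resolvingCount-short 0<d d<n n≤) 2∤n))
    (s≤s z≤n) (s≤s (s≤s z≤n)) (resolvingCount-odd-≤ 3≤n 2∤n)
  even-case : n ≤ 2 * k + 3 → 2 ∣ n → FracDimEq k n (ratio n (n ∸ 2))
  even-case n≤ 2∣n = minCount⇒fracDimEq
    (λ d 0<d d<n → ≤-pred (≤-pred (proj₁ (resolvingCount-short 0<d d<n n≤))))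
    (s≤s z≤n) (s≤s (s≤s (s≤s z≤n))) (resolvingCount-even-≤ 3≤n 2∣n)
  long-case : 2 * k + 4 ≤ n → FracDimEq k n (ratio n (2 * (k + 1)))
  long-case n≥ = subst (λ c → FracDimEq k n (ratio n c)) (sym (2[k+1]≡ k)) (minCount⇒fracDimEq
    (λ d 0<d d<n → resolvingCount-long 0<d d<n n≥)
    (s≤s z≤n) (s≤s (s≤s z≤n)) (resolvingCount-1-≤ {k} {n} (s≤s z≤n)))
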